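{- Let $r\geq 2$, $t\geq 1$, $k$ be positive integers and let $\mathcal{G}$ be a nonempty family of $k$-element subsets of a finite set which is $r$-wise $t$-intersecting but is not a $t$-star, i.e. $\left|\bigcap_{G\in\mathcal{G}}G\right|<t$. Then either $k\geq t+r$, or $k=t+r-1$ and $\mathcal{G}\subset\binom{Y}{k}$ for some $(k+1)$-element set $Y$.
   Context: A family $\mathcal{G}$ is $r$-wise $t$-intersecting if $|G_1\cap\dots\cap G_r|\geq t$ for all (not necessarily distinct) $G_1,\dots,G_r\in\mathcal{G}$. $\binom{Y}{k}$ is the set of $k$-element subsets of $Y$. -}

module Defs where

open import Data.Nat using (ℕ; _≥_; _<_)
open import Data.List using (List; [])
open import Data.List.Membership.Propositional using (_∈_)
open import Data.List.Relation.Unary.All using (All)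
open import Data.Vec using (Vec; toList)
open import Data.Fin.Subset using (Subset; ⋂; ∣_∣; _⊆_)
open import Relation.Binary.PropositionalEquality using (_≡_)

Family : ℕ → Set
Family n = List (Subset n)

Uniform : {n : ℕ} → ℕ → Family n → Set
Uniform k 𝒢 = All (λ G → ∣ G ∣ ≡ k) 𝒢

RWiseTIntersecting : {n : ℕ} → ℕ → ℕ → Family n → Set
RWiseTIntersecting {n} r t 𝒢 =
  (Gs : Vec (Subset n) r) → All (_∈ 𝒢) (toList Gs) → ∣ ⋂ (toList Gs) ∣ ≥ t

-- 𝒢 ⊆ (Y choose k) with |Y| = k+1: every member is contained in Y.
AllIn : {n : ℕ} → Subset n → Family n → Set
AllIn Y 𝒢 = All (_⊆ Y) 𝒢

{-# OPTIONS --safe #-}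
module Submission where

-- If any i + 1 ≤ r members meet in at least s > |⋂ 𝒢| points, then any i members meet in at
-- least s + 1: some point of their intersection is missed by a member G, and adding G still leaves
-- s points. Iterating from s = t, every member has at least t + r - 1 elements and any two share
-- at least t + r - 2. So if k = t + r - 1, any two members differ in a single element, and such a
-- family whose members do not all contain a common (k - 1)-set lies in the union of two of its
-- members, a (k + 1)-set.

open import Defs
open import Data.Nat using (ℕ; _≥_; _<_; _≤_; _+_; _∸_; suc; zero; s≤s; s≤s⁻¹)
open import Data.Nat.Properties hiding (_≟_)
open import Data.Product using (Σ; _×_; _,_; ∃; proj₁; proj₂)
open import Data.Sum as Sum using (_⊎_)
open import Data.List using (List; []; _∷_)
open import Data.List.Membership.Propositional using (find) renaming (_∈_ to _∈ₗ_)
open import Data.List.Relation.Unary.All as All using (All; _∷_)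
open import Data.List.Relation.Unary.All.Properties using (¬All⇒Any¬)
open import Data.List.Relation.Unary.Any using (here)
open import Data.Vec as Vec using (toList)
open import Data.Fin using (Fin; _≟_)
open import Data.Fin.Properties using (¬∀⟶∃¬)
open import Data.Fin.Subset using (Subset; ⋂; ∣_∣; _∈_; _∉_; _⊆_; _∩_; _∪_; _-_; inside; outside)
open import Data.Fin.Subset.Properties
open import Function using (_∘_; const)
open import Relation.Nullary using (¬_; contradiction)
open import Relation.Nullary.Decidable using (decidable-stable; _→-dec_)
open import Relation.Binary.PropositionalEquality
  using (_≡_; _≢_; refl; sym; trans; cong; cong₂; subst; module ≡-Reasoning)
open import Data.Empty using (⊥-elim)

private
  variable
    n i j m s : ℕ
    x y : Fin n
    p q : Subset n
    g : Subset n
    𝒢 : Family n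

∣p∪q∣+∣p∩q∣≡∣p∣+∣q∣ : (p q : Subset n) → ∣ p ∪ q ∣ + ∣ p ∩ q ∣ ≡ ∣ p ∣ + ∣ q ∣
∣p∪q∣+∣p∩q∣≡∣p∣+∣q∣ Vec.[] Vec.[] = refl
∣p∪q∣+∣p∩q∣≡∣p∣+∣q∣ (inside Vec.∷ p) (inside Vec.∷ q) =
  cong suc (trans (+-suc _ _) (trans (cong suc (∣p∪q∣+∣p∩q∣≡∣p∣+∣q∣ p q)) (sym (+-suc _ _))))
∣p∪q∣+∣p∩q∣≡∣p∣+∣q∣ (inside Vec.∷ p) (outside Vec.∷ q) = cong suc (∣p∪q∣+∣p∩q∣≡∣p∣+∣q∣ p q)
∣p∪q∣+∣p∩q∣≡∣p∣+∣q∣ (outside Vec.∷ p) (inside Vec.∷ q) =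
  trans (cong suc (∣p∪q∣+∣p∩q∣≡∣p∣+∣q∣ p q)) (sym (+-suc _ _))
∣p∪q∣+∣p∩q∣≡∣p∣+∣q∣ (outside Vec.∷ p) (outside Vec.∷ q) = ∣p∪q∣+∣p∩q∣≡∣p∣+∣q∣ p q

x∈p∧y∉p⇒x≢y : x ∈ p → y ∉ p → x ≢ y
x∈p∧y∉p⇒x≢y x∈p y∉p refl = y∉p x∈p

x∉p∧x∈q⇒∣p∩q∣<∣q∣ : x ∉ p → x ∈ q → ∣ p ∩ q ∣ < ∣ q ∣
x∉p∧x∈q⇒∣p∩q∣<∣q∣ {p = p} {q = q} x∉p x∈q =
  p⊂q⇒∣p∣<∣q∣ (p∩q⊆q p q , _ , x∈q , x∉p ∘ proj₁ ∘ x∈p∩q⁻ p q)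

two-outside⇒2+∣p∩q∣≤∣p∣ : x ∈ p → x ∉ q → y ∈ p → y ∉ q → x ≢ y → 2 + ∣ p ∩ q ∣ ≤ ∣ p ∣
two-outside⇒2+∣p∩q∣≤∣p∣ {x = x} {p = p} {q = q} {y = y} x∈p x∉q y∈p y∉q x≢y =
  ≤-trans (s≤s (≤-trans (s≤s (p⊆q⇒∣p∣≤∣q∣ p∩q⊆p-x-y)) (x∈p⇒∣p-x∣<∣p∣ y∈p-x)))
          (x∈p⇒∣p-x∣<∣p∣ x∈p)
  where
  y∈p-x : y ∈ p - x
  y∈p-x = x∈p∧x≢y⇒x∈p-y y∈p (x≢y ∘ sym)
  p∩q⊆p-x-y : p ∩ q ⊆ p - x - y
  p∩q⊆p-x-y {z} z∈p∩q =
    let z∈p , z∈q = x∈p∩q⁻ p q z∈p∩q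
    in x∈p∧x≢y⇒x∈p-y (x∈p∧x≢y⇒x∈p-y z∈p (x∈p∧y∉p⇒x≢y z∈q x∉q)) (x∈p∧y∉p⇒x≢y z∈q y∉q)

∣q∣<∣p∣⇒∃x∈p∧x∉q : ∣ q ∣ < ∣ p ∣ → ∃ λ x → x ∈ p × x ∉ q
∣q∣<∣p∣⇒∃x∈p∧x∉q {n} {q} {p} ∣q∣<∣p∣ =
  witness (¬∀⟶∃¬ n (λ x → x ∈ p → x ∈ q) (λ x → x ∈? p →-dec x ∈? q)
                   (λ p⊆q → <⇒≱ ∣q∣<∣p∣ (p⊆q⇒∣p∣≤∣q∣ (p⊆q _))))
  where
  witness : (∃ λ x → ¬ (x ∈ p → x ∈ q)) → ∃ λ x → x ∈ p × x ∉ q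
  witness (x , p↛q) =
    x , decidable-stable (x ∈? p) (λ x∉p → p↛q (λ x∈p → contradiction x∈p x∉p)) , p↛q ∘ const

x∈⋂⁺ : (L : List (Subset n)) → All (x ∈_) L → x ∈ ⋂ L
x∈⋂⁺ [] All.[] = ∈⊤
x∈⋂⁺ (G ∷ L) (x∈G ∷ x∈L) = x∈p∩q⁺ (x∈G , x∈⋂⁺ L x∈L)

x∉⋂⇒∃x∉ : (L : List (Subset n)) → x ∉ ⋂ L → ∃ λ G → G ∈ₗ L × x ∉ G
x∉⋂⇒∃x∉ {x = x} L x∉⋂L = find (¬All⇒Any¬ (x ∈?_) L (x∉⋂L ∘ x∈⋂⁺ L))

rwise-step : g ∈ₗ 𝒢 → ∣ ⋂ 𝒢 ∣ < s →
  RWiseTIntersecting (suc i) s 𝒢 → RWiseTIntersecting i (suc s) 𝒢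
rwise-step {g = g} {𝒢 = 𝒢} {s = s} g∈𝒢 not-star intersecting Gs Gs∈𝒢 =
  grow (∣q∣<∣p∣⇒∃x∈p∧x∉q (<-≤-trans not-star s≤∣⋂Gs∣))
  where
  s≤∣⋂Gs∣ : s ≤ ∣ ⋂ (toList Gs) ∣
  s≤∣⋂Gs∣ = ≤-trans (intersecting (g Vec.∷ Gs) (g∈𝒢 ∷ Gs∈𝒢)) (p⊆q⇒∣p∣≤∣q∣ (p∩q⊆q g _))
  grow : (∃ λ x → x ∈ ⋂ (toList Gs) × x ∉ ⋂ 𝒢) → suc s ≤ ∣ ⋂ (toList Gs) ∣
  grow (x , x∈⋂Gs , x∉⋂𝒢) with x∉⋂⇒∃x∉ 𝒢 x∉⋂𝒢
  ... | G , G∈𝒢 , x∉G =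
    <-≤-trans (s≤s (intersecting (G Vec.∷ Gs) (G∈𝒢 ∷ Gs∈𝒢))) (x∉p∧x∈q⇒∣p∩q∣<∣q∣ x∉G x∈⋂Gs)

rwise-grow : g ∈ₗ 𝒢 → ∣ ⋂ 𝒢 ∣ < s →
  RWiseTIntersecting (i + j) s 𝒢 → RWiseTIntersecting i (j + s) 𝒢
rwise-grow {𝒢 = 𝒢} {s = s} {i = i} {j = zero} _ _ intersecting =
  subst (λ r → RWiseTIntersecting r s 𝒢) (+-identityʳ i) intersecting
rwise-grow {𝒢 = 𝒢} {s = s} {i = i} {j = suc j} g∈𝒢 not-star intersecting =
  rwise-step g∈𝒢 (<-≤-trans not-star (m≤n+m s j))
    (rwise-grow g∈𝒢 not-star (subst (λ r → RWiseTIntersecting r s 𝒢) (+-suc i j) intersecting))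

rwise-pair : RWiseTIntersecting 2 s 𝒢 → {G H : Subset n} → G ∈ₗ 𝒢 → H ∈ₗ 𝒢 → s ≤ ∣ G ∩ H ∣
rwise-pair {s = s} intersecting {G} {H} G∈𝒢 H∈𝒢 =
  subst (λ K → s ≤ ∣ G ∩ K ∣) (∩-identityʳ H)
    (intersecting (G Vec.∷ H Vec.∷ Vec.[]) (G∈𝒢 ∷ H∈𝒢 ∷ All.[]))

AtMostOneOutside : Family n → Set
AtMostOneOutside {n} 𝒢 = ∀ {G H : Subset n} {x y : Fin n} → G ∈ₗ 𝒢 → H ∈ₗ 𝒢 →
  x ∈ G → x ∉ H → y ∈ G → y ∉ H → x ≡ y

uniform∧2-wise⇒atMostOneOutside : Uniform (suc m) 𝒢 → RWiseTIntersecting 2 m 𝒢 →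
  AtMostOneOutside 𝒢
uniform∧2-wise⇒atMostOneOutside {m = m} uniform intersecting {G} {H} {x} {y}
  G∈𝒢 H∈𝒢 x∈G x∉H y∈G y∉H =
  decidable-stable (x ≟ y) λ x≢y →
    1+n≰n (subst (2 + m ≤_) (All.lookup uniform G∈𝒢)
      (≤-trans (s≤s (s≤s (rwise-pair intersecting G∈𝒢 H∈𝒢))) (two-outside⇒2+∣p∩q∣≤∣p∣ x∈G x∉H y∈G y∉H x≢y)))

module _ {𝒢 : Family n} (one-outside : AtMostOneOutside 𝒢) where

  ∉A∪B⇒A∩B⊆⋂ : {A B H : Subset n} {d z : Fin n} → A ∈ₗ 𝒢 → B ∈ₗ 𝒢 → H ∈ₗ 𝒢 →
    d ∈ A → d ∉ B → z ∈ H → z ∉ A ∪ B → A ∩ B ⊆ ⋂ 𝒢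
  ∉A∪B⇒A∩B⊆⋂ {A} {B} {H} {d} {z} A∈𝒢 B∈𝒢 H∈𝒢 d∈A d∉B z∈H z∉A∪B {c} c∈A∩B =
    x∈⋂⁺ 𝒢 (All.tabulate c∈K)
    where
    -- d is the only point of A outside H, so H ⊇ A ∩ B; a member K missing c ∈ A ∩ B would
    -- then contain z (as H ─ K = {c}) and d (as A ─ K = {c}), two points outside B.
    z∉A : z ∉ A
    z∉A = z∉A∪B ∘ p⊆p∪q B
    z∉B : z ∉ B
    z∉B = z∉A∪B ∘ q⊆p∪q A B
    c∈A : c ∈ A
    c∈A = proj₁ (x∈p∩q⁻ A B c∈A∩B)
    c∈B : c ∈ B
    c∈B = proj₂ (x∈p∩q⁻ A B c∈A∩B)
    d∉H : d ∉ H
    d∉H d∈H = x∈p∧y∉p⇒x≢y d∈A z∉A (one-outside H∈𝒢 B∈𝒢 d∈H d∉B z∈H z∉B)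
    c∈H : c ∈ H
    c∈H = decidable-stable (c ∈? H) λ c∉H →
      x∈p∧y∉p⇒x≢y c∈B d∉B (one-outside A∈𝒢 H∈𝒢 c∈A c∉H d∈A d∉H)
    c∈K : {K : Subset n} → K ∈ₗ 𝒢 → c ∈ K
    c∈K {K} K∈𝒢 = decidable-stable (c ∈? K) λ c∉K →
      let z∈K = decidable-stable (z ∈? K) λ z∉K →
                  x∈p∧y∉p⇒x≢y c∈A z∉A (one-outside H∈𝒢 K∈𝒢 c∈H c∉K z∈H z∉K)
          d∈K = decidable-stable (d ∈? K) λ d∉K →
                  x∈p∧y∉p⇒x≢y c∈B d∉B (one-outside A∈𝒢 K∈𝒢 c∈A c∉K d∈A d∉K)
      in x∈p∧y∉p⇒x≢y d∈A z∉A (one-outside K∈𝒢 B∈𝒢 d∈K d∉B z∈K z∉B)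

module _ {𝒢 : Family n} (uniform : Uniform (suc m) 𝒢) (intersecting : RWiseTIntersecting 2 m 𝒢)
         (not-star : ∣ ⋂ 𝒢 ∣ < m) where

  private
    size : {G : Subset n} → G ∈ₗ 𝒢 → ∣ G ∣ ≡ suc m
    size = All.lookup uniform

  G∪g-cover : {G g : Subset n} {x : Fin n} → G ∈ₗ 𝒢 → g ∈ₗ 𝒢 → x ∉ G → x ∈ g →
    ∣ G ∪ g ∣ ≡ 2 + m × AllIn (G ∪ g) 𝒢
  G∪g-cover {G} {g} G∈𝒢 g∈𝒢 x∉G x∈g = cover (∣q∣<∣p∣⇒∃x∈p∧x∉q ∣G∩g∣<∣G∣)
    where
    ∣G∩g∣<suc-m : ∣ G ∩ g ∣ < suc m
    ∣G∩g∣<suc-m = subst (∣ G ∩ g ∣ <_) (size g∈𝒢) (x∉p∧x∈q⇒∣p∩q∣<∣q∣ x∉G x∈g)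
    ∣G∩g∣<∣G∣ : ∣ G ∩ g ∣ < ∣ G ∣
    ∣G∩g∣<∣G∣ = subst (∣ G ∩ g ∣ <_) (sym (size G∈𝒢)) ∣G∩g∣<suc-m
    ∣G∩g∣≡m : ∣ G ∩ g ∣ ≡ m
    ∣G∩g∣≡m = ≤-antisym (s≤s⁻¹ ∣G∩g∣<suc-m) (rwise-pair intersecting G∈𝒢 g∈𝒢)
    ∣G∪g∣≡2+m : ∣ G ∪ g ∣ ≡ 2 + m
    ∣G∪g∣≡2+m = +-cancelʳ-≡ m _ _ (begin
      ∣ G ∪ g ∣ + m            ≡⟨ cong (∣ G ∪ g ∣ +_) (sym ∣G∩g∣≡m) ⟩
      ∣ G ∪ g ∣ + ∣ G ∩ g ∣    ≡⟨ ∣p∪q∣+∣p∩q∣≡∣p∣+∣q∣ G g ⟩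
      ∣ G ∣ + ∣ g ∣            ≡⟨ cong₂ _+_ (size G∈𝒢) (size g∈𝒢) ⟩
      suc m + suc m           ≡⟨ cong suc (+-suc m m) ⟩
      2 + m + m               ∎)
      where open ≡-Reasoning
    cover : (∃ λ d → d ∈ G × d ∉ G ∩ g) → ∣ G ∪ g ∣ ≡ 2 + m × AllIn (G ∪ g) 𝒢
    cover (d , d∈G , d∉G∩g) = ∣G∪g∣≡2+m , All.tabulate ⊆G∪g
      where
      d∉g : d ∉ g
      d∉g d∈g = d∉G∩g (x∈p∩q⁺ (d∈G , d∈g))
      ⊆G∪g : {H : Subset n} → H ∈ₗ 𝒢 → H ⊆ G ∪ g
      ⊆G∪g H∈𝒢 {z} z∈H = decidable-stable (z ∈? G ∪ g) λ z∉G∪g →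
        <⇒≱ not-star (≤-trans (rwise-pair intersecting G∈𝒢 g∈𝒢) (p⊆q⇒∣p∣≤∣q∣
          (∉A∪B⇒A∩B⊆⋂ (uniform∧2-wise⇒atMostOneOutside uniform intersecting)
            G∈𝒢 g∈𝒢 H∈𝒢 d∈G d∉g z∈H z∉G∪g)))

  covered-by-2+m-set : {g : Subset n} → g ∈ₗ 𝒢 → Σ (Subset n) λ Y → ∣ Y ∣ ≡ 2 + m × AllIn Y 𝒢
  covered-by-2+m-set {g} g∈𝒢 = from-x (∣q∣<∣p∣⇒∃x∈p∧x∉q ∣⋂𝒢∣<∣g∣)
    where
    ∣⋂𝒢∣<∣g∣ : ∣ ⋂ 𝒢 ∣ < ∣ g ∣
    ∣⋂𝒢∣<∣g∣ = <-≤-trans not-star (subst (m ≤_) (sym (size g∈𝒢)) (n≤1+n m))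
    from-x : (∃ λ x → x ∈ g × x ∉ ⋂ 𝒢) → Σ (Subset n) λ Y → ∣ Y ∣ ≡ 2 + m × AllIn Y 𝒢
    from-x (x , x∈g , x∉⋂𝒢) with x∉⋂⇒∃x∉ 𝒢 x∉⋂𝒢
    ... | G , G∈𝒢 , x∉G = G ∪ g , G∪g-cover G∈𝒢 g∈𝒢 x∉G x∈g

proposition1p7 : (n r t k : ℕ) → r ≥ 2 → t ≥ 1 → k ≥ 1 →
    (𝒢 : Family n) → ¬ (𝒢 ≡ []) → Uniform k 𝒢 →
    RWiseTIntersecting r t 𝒢 → ∣ ⋂ 𝒢 ∣ < t →
    (k ≥ t + r) ⊎
    ((k ≡ t + r ∸ 1) × Σ (Subset n) (λ Y → (∣ Y ∣ ≡ suc k) × AllIn Y 𝒢))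
proposition1p7 n r t k _ _ _ [] 𝒢≢[] _ _ _ = ⊥-elim (𝒢≢[] refl)
proposition1p7 n (suc (suc r)) t k (s≤s (s≤s _)) _ _ 𝒢@(g ∷ _) _ uniform intersecting not-star =
  Sum.map (subst (_≤ k) (sym t+2+r≡2+r+t)) covered (m≤n⇒m<n∨m≡n 1+r+t≤k)
  where
  g∈𝒢 : g ∈ₗ 𝒢
  g∈𝒢 = here refl
  not-r+t-star : ∣ ⋂ 𝒢 ∣ < r + t
  not-r+t-star = <-≤-trans not-star (m≤n+m t r)
  pair : RWiseTIntersecting 2 (r + t) 𝒢
  pair = rwise-grow g∈𝒢 not-star intersecting
  1+r+t≤k : suc (r + t) ≤ k
  1+r+t≤k = subst (suc (r + t) ≤_) (trans (cong ∣_∣ (∩-identityʳ g)) (All.lookup uniform g∈𝒢))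
    (rwise-step g∈𝒢 not-r+t-star pair (g Vec.∷ Vec.[]) (g∈𝒢 ∷ All.[]))
  t+2+r≡2+r+t : t + suc (suc r) ≡ suc (suc (r + t))
  t+2+r≡2+r+t = +-comm t (suc (suc r))
  covered : suc (r + t) ≡ k →
    (k ≡ t + suc (suc r) ∸ 1) × Σ (Subset n) (λ Y → (∣ Y ∣ ≡ suc k) × AllIn Y 𝒢)
  covered 1+r+t≡k =
    let Y , ∣Y∣≡2+r+t , 𝒢⊆Y = covered-by-2+m-set (subst (λ k → Uniform k 𝒢) (sym 1+r+t≡k) uniform)
                                 pair not-r+t-star g∈𝒢
    in trans (sym 1+r+t≡k) (cong (_∸ 1) (sym t+2+r≡2+r+t)) ,
       Y , trans ∣Y∣≡2+r+t (cong suc 1+r+t≡k) , 𝒢⊆Y
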